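{- Let $E=\{a,b\}$ be an alphabet of two letters. Let $m$ be a non-zero integer and let $W\in\mathrm{Mat}_{2\times2}(\mathbb{Z})$ with $W^2\equiv0\bmod m$. Assume there exist primitive matrices $W_1,W_2\in\mathrm{Mat}_{2\times2}(\mathbb{Z})$ of determinant $m$ with $W_1\equiv W_2\equiv W\bmod m$, and let $\Phi\colon E^*\to{\mathcal{P}}$ be the morphism of monoids mapping $a$ to $W_2$ and $b$ to $W_1$. Then for each word $u\in E^*$, $\det\Phi(u)=1$ if $u$ has even length and $\det\Phi(u)=m$ if $u$ has odd length.
   Context: ${\mathcal{P}}$ is the set of primitive (entries with gcd 1) integer $2\times2$ matrices with non-zero determinant, a group under $A*B=(AB)^{\mathrm{red}}$, where $C^{\mathrm{red}}$ is $C$ divided by the positive gcd of its entries; the morphism $\Phi$ is with respect to this product, and $\Phi$ of the empty word is the identity. $E^*$ is the free monoid of words over $E$. Congruences mod $m$ of matrices are entrywise. -}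

module Defs where

open import Data.Nat as ℕ using (ℕ; zero; suc)
open import Data.Nat.GCD using (gcd)
open import Data.Integer using (ℤ; +_; _+_; _-_; _*_; ∣_∣)
open import Data.Integer.DivMod using (_/ℕ_)
open import Data.Integer.Divisibility using (_∣_)
open import Data.List using (List; []; _∷_)
open import Data.Product using (_×_)
import Relation.Binary.PropositionalEquality as P

record Mat : Set where
  constructor mat
  field
    e11 e12 e21 e22 : ℤ
open Mat public

det : Mat → ℤ
det (mat a b c d) = a * d - b * c

_·_ : Mat → Mat → Mat
mat a b c d · mat a' b' c' d' =
  mat (a * a' + b * c') (a * b' + b * d') (c * a' + d * c') (c * b' + d * d')

I₂ : Mat
I₂ = mat (+ 1) (+ 0) (+ 0) (+ 1)

content : Mat → ℕ
content (mat a b c d) = gcd (gcd ∣ a ∣ ∣ b ∣) (gcd ∣ c ∣ ∣ d ∣)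

Primitive : Mat → Set
Primitive M = content M P.≡ 1

-- C^red : C divided by the positive gcd of its entries
-- (the zero matrix, whose gcd is 0, is left unchanged; it never occurs in 𝒫)
divBy : (g : ℕ) → Mat → Mat
divBy zero M = M
divBy (suc k) (mat a b c d) =
  mat (a /ℕ suc k) (b /ℕ suc k) (c /ℕ suc k) (d /ℕ suc k)

red : Mat → Mat
red M = divBy (content M) M

-- the group law of 𝒫 :  A * B = (AB)^red
_⊛_ : Mat → Mat → Mat
A ⊛ B = red (A · B)

_≡_[mod_] : Mat → Mat → ℤ → Set
A ≡ B [mod m ] =
  (m ∣ (e11 A - e11 B)) × (m ∣ (e12 A - e12 B)) ×
  (m ∣ (e21 A - e21 B)) × (m ∣ (e22 A - e22 B))

data Letter : Set where
  a b : Letter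

Φ : Mat → Mat → List Letter → Mat
Φ Wa Wb [] = I₂
Φ Wa Wb (a ∷ u) = Wa ⊛ Φ Wa Wb u
Φ Wa Wb (b ∷ u) = Wb ⊛ Φ Wa Wb u

{-# OPTIONS --safe #-}
module Submission where

-- Write Φ (x ∷ u) = W_x ⊛ Φ u. If det N = 1 then N is invertible over ℤ, so W_x N is still
-- primitive and W_x ⊛ N = W_x N has determinant m. For two letters, W_x W_y ≡ W² ≡ 0 mod m,
-- so W_x W_y = m Q with m² det Q = m², i.e. det Q = 1. Then W_x (W_y N) = m (Q N) with Q N
-- unimodular, hence primitive, and reduction strips exactly the scalar ±m, leaving determinant 1.
-- Induction on the word, two letters at a time, gives both parities.

open import Defs
open import Data.Nat as ℕ using (ℕ; suc; _%_)
import Data.Nat.Divisibility as ℕ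
import Data.Nat.DivMod as ℕ
import Data.Nat.GCD as ℕ
import Data.Nat.Properties as ℕ
open import Data.Integer
  using (ℤ; +_; +[1+_]; -[1+_]; 0ℤ; 1ℤ; -1ℤ; _+_; _-_; _*_; -_; ∣_∣; NonZero; ≢-nonZero)
open import Data.Integer.DivMod using (_/ℕ_)
open import Data.Integer.Properties
  using (-1*i≡-i; pos-*; abs-*; *-assoc; *-comm; *-identityˡ; *-identityʳ; +-identityʳ; *-cancelˡ-≡)
open import Data.Integer.Divisibility using (_∣_)
open import Data.Integer.Divisibility.Signed as Signed
  using (∣ᵤ⇒∣; ∣⇒∣ᵤ; ∣-refl; ∣m∣n⇒∣m+n; ∣m⇒∣m*n; ∣n⇒∣m*n)
open import Data.Integer.Tactic.RingSolver using (solve-∀)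
open import Data.List using (List; []; _∷_; length)
open import Data.Product using (_×_; _,_)
open import Function using (_∘_)
open import Relation.Binary.PropositionalEquality
  using (_≡_; _≢_; refl; sym; trans; cong; cong₂; subst; module ≡-Reasoning)
open import Relation.Nullary using (contradiction)

open ≡-Reasoning

infixr 8 _*ₗ_

_*ₗ_ : ℤ → Mat → Mat
k *ₗ mat p q r s = mat (k * p) (k * q) (k * r) (k * s)

adj : Mat → Mat
adj (mat p q r s) = mat s (- q) (- r) p

mat-cong : ∀ {p q r s p′ q′ r′ s′} → p ≡ p′ → q ≡ q′ → r ≡ r′ → s ≡ s′ →
           mat p q r s ≡ mat p′ q′ r′ s′
mat-cong refl refl refl refl = refl

·-assoc : ∀ A B C → (A · B) · C ≡ A · (B · C)
·-assoc (mat a₁ a₂ a₃ a₄) (mat b₁ b₂ b₃ b₄) (mat c₁ c₂ c₃ c₄) = mat-cong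
  (entry b₁ b₂ b₃ b₄ a₁ a₂ c₁ c₃) (entry b₁ b₂ b₃ b₄ a₁ a₂ c₂ c₄)
  (entry b₁ b₂ b₃ b₄ a₃ a₄ c₁ c₃) (entry b₁ b₂ b₃ b₄ a₃ a₄ c₂ c₄)
  where
  entry : ∀ b₁ b₂ b₃ b₄ x y u v →
    (x * b₁ + y * b₃) * u + (x * b₂ + y * b₄) * v ≡ x * (b₁ * u + b₂ * v) + y * (b₃ * u + b₄ * v)
  entry = solve-∀

det-· : ∀ A B → det (A · B) ≡ det A * det B
det-· (mat p q r s) (mat p′ q′ r′ s′) = identity p q r s p′ q′ r′ s′
  where
  identity : ∀ p q r s p′ q′ r′ s′ →
    (p * p′ + q * r′) * (r * q′ + s * s′) - (p * q′ + q * s′) * (r * p′ + s * r′) ≡ (p * s - q * r) * (p′ * s′ - q′ * r′)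
  identity = solve-∀

det-*ₗ : ∀ k A → det (k *ₗ A) ≡ k * (k * det A)
det-*ₗ k (mat p q r s) = identity k p q r s
  where
  identity : ∀ k p q r s → k * p * (k * s) - k * q * (k * r) ≡ k * (k * (p * s - q * r))
  identity = solve-∀

*ₗ-· : ∀ k A B → (k *ₗ A) · B ≡ k *ₗ (A · B)
*ₗ-· k (mat a₁ a₂ a₃ a₄) (mat b₁ b₂ b₃ b₄) =
  mat-cong (entry k a₁ a₂ b₁ b₃) (entry k a₁ a₂ b₂ b₄) (entry k a₃ a₄ b₁ b₃) (entry k a₃ a₄ b₂ b₄)
  where
  entry : ∀ k x y u v → k * x * u + k * y * v ≡ k * (x * u + y * v)
  entry = solve-∀

*ₗ-assoc : ∀ j k A → (j * k) *ₗ A ≡ j *ₗ (k *ₗ A)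
*ₗ-assoc j k (mat p q r s) = mat-cong (*-assoc j k p) (*-assoc j k q) (*-assoc j k r) (*-assoc j k s)

*ₗ-identityˡ : ∀ A → 1ℤ *ₗ A ≡ A
*ₗ-identityˡ (mat p q r s) = mat-cong (*-identityˡ p) (*-identityˡ q) (*-identityˡ r) (*-identityˡ s)

·-·adj : ∀ A N → (A · N) · adj N ≡ det N *ₗ A
·-·adj (mat a₁ a₂ a₃ a₄) (mat n₁ n₂ n₃ n₄) =
  mat-cong (first n₁ n₂ n₃ n₄ a₁ a₂) (second n₁ n₂ n₃ n₄ a₁ a₂) (first n₁ n₂ n₃ n₄ a₃ a₄) (second n₁ n₂ n₃ n₄ a₃ a₄)
  where
  first : ∀ n₁ n₂ n₃ n₄ x y → (x * n₁ + y * n₃) * n₄ + (x * n₂ + y * n₄) * - n₃ ≡ (n₁ * n₄ - n₂ * n₃) * x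
  first = solve-∀
  second : ∀ n₁ n₂ n₃ n₄ x y → (x * n₁ + y * n₃) * - n₂ + (x * n₂ + y * n₄) * n₁ ≡ (n₁ * n₄ - n₂ * n₃) * y
  second = solve-∀

infix 4 _∣ᴹ_

record _∣ᴹ_ (k : ℤ) (M : Mat) : Set where
  constructor divides
  field
    quotient : Mat
    equality : M ≡ k *ₗ quotient

∣-entries⇒∣ᴹ : ∀ {k p q r s} → k Signed.∣ p → k Signed.∣ q → k Signed.∣ r → k Signed.∣ s → k ∣ᴹ mat p q r s
∣-entries⇒∣ᴹ {k} (Signed.divides p′ p≡) (Signed.divides q′ q≡) (Signed.divides r′ r≡) (Signed.divides s′ s≡) =
  divides (mat p′ q′ r′ s′) (mat-cong (trans p≡ (*-comm p′ k)) (trans q≡ (*-comm q′ k)) (trans r≡ (*-comm r′ k)) (trans s≡ (*-comm s′ k)))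

∣ᴹ-·ʳ : ∀ {k A} → k ∣ᴹ A → ∀ B → k ∣ᴹ A · B
∣ᴹ-·ʳ {k} (divides Q refl) B = divides (Q · B) (*ₗ-· k Q B)

∣ᴹ⇒∣det : ∀ {k M} → k ∣ᴹ M → k Signed.∣ det M
∣ᴹ⇒∣det {k} (divides Q refl) = subst (k Signed.∣_) (sym (det-*ₗ k Q)) (∣m⇒∣m*n (k * det Q) ∣-refl)

content-*ₗ : ∀ k M → content (k *ₗ M) ≡ ∣ k ∣ ℕ.* content M
content-*ₗ k (mat p q r s)
  rewrite abs-* k p | abs-* k q | abs-* k r | abs-* k s
        | sym (ℕ.c*gcd[m,n]≡gcd[cm,cn] (∣ k ∣) (∣ p ∣) (∣ q ∣)) | sym (ℕ.c*gcd[m,n]≡gcd[cm,cn] (∣ k ∣) (∣ r ∣) (∣ s ∣))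
  = sym (ℕ.c*gcd[m,n]≡gcd[cm,cn] (∣ k ∣) _ _)

∣ᴹ⇒∣content : ∀ {k M} → k ∣ᴹ M → ∣ k ∣ ℕ.∣ content M
∣ᴹ⇒∣content {k} (divides Q refl) = subst (∣ k ∣ ℕ.∣_) (sym (content-*ₗ k Q)) (ℕ.m∣m*n (content Q))

content-∣ᴹ : ∀ M → + content M ∣ᴹ M
content-∣ᴹ M@(mat p q r s) = ∣-entries⇒∣ᴹ {+ content M}
  (∣ᵤ⇒∣ (ℕ.∣-trans c∣g₁ (ℕ.gcd[m,n]∣m (∣ p ∣) (∣ q ∣)))) (∣ᵤ⇒∣ (ℕ.∣-trans c∣g₁ (ℕ.gcd[m,n]∣n (∣ p ∣) (∣ q ∣))))
  (∣ᵤ⇒∣ (ℕ.∣-trans c∣g₂ (ℕ.gcd[m,n]∣m (∣ r ∣) (∣ s ∣)))) (∣ᵤ⇒∣ (ℕ.∣-trans c∣g₂ (ℕ.gcd[m,n]∣n (∣ r ∣) (∣ s ∣))))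
  where
  g₁ g₂ : ℕ
  g₁ = ℕ.gcd (∣ p ∣) (∣ q ∣)
  g₂ = ℕ.gcd (∣ r ∣) (∣ s ∣)
  c∣g₁ : content M ℕ.∣ g₁
  c∣g₁ = ℕ.gcd[m,n]∣m g₁ g₂
  c∣g₂ : content M ℕ.∣ g₂
  c∣g₂ = ℕ.gcd[m,n]∣n g₁ g₂

det≡1⇒primitive : ∀ M → det M ≡ 1ℤ → Primitive M
det≡1⇒primitive M det≡1 = ℕ.∣1⇒≡1 (∣⇒∣ᵤ c∣1)
  where
  c∣1 : + content M Signed.∣ 1ℤ
  c∣1 = subst (+ content M Signed.∣_) det≡1 (∣ᴹ⇒∣det (content-∣ᴹ M))

primitive-·-unimodular : ∀ A N → Primitive A → det N ≡ 1ℤ → Primitive (A · N)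
primitive-·-unimodular A N primA det≡1 = ℕ.∣1⇒≡1 (subst (c ℕ.∣_) primA c∣content[A])
  where
  c : ℕ
  c = content (A · N)
  A·N·adjN≡A : (A · N) · adj N ≡ A
  A·N·adjN≡A = trans (·-·adj A N) (trans (cong (_*ₗ A) det≡1) (*ₗ-identityˡ A))
  c∣content[A] : c ℕ.∣ content A
  c∣content[A] = ∣ᴹ⇒∣content (subst (+ c ∣ᴹ_) A·N·adjN≡A (∣ᴹ-·ʳ (content-∣ᴹ (A · N)) (adj N)))

[1+k]*i/ℕ[1+k]≡i : ∀ k i → (+[1+ k ] * i) /ℕ suc k ≡ i
[1+k]*i/ℕ[1+k]≡i k (+ n) = begin
  (+[1+ k ] * + n) /ℕ suc k  ≡⟨ cong (_/ℕ suc k) (sym (pos-* (suc k) n)) ⟩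
  + (suc k ℕ.* n ℕ./ suc k)  ≡⟨ cong (λ z → + (z ℕ./ suc k)) (ℕ.*-comm (suc k) n) ⟩
  + (n ℕ.* suc k ℕ./ suc k)  ≡⟨ cong +_ (ℕ.m*n/n≡m n (suc k)) ⟩
  + n                        ∎
[1+k]*i/ℕ[1+k]≡i k -[1+ n ] = begin
  -[1+ n ℕ.+ k ℕ.* suc n ] /ℕ suc k  ≡⟨ -[1+m]/ℕd (n ℕ.+ k ℕ.* suc n) (suc k) [1+k][1+n]%[1+k]≡0 ⟩
  - + (suc k ℕ.* suc n ℕ./ suc k)     ≡⟨ cong (λ z → - + (z ℕ./ suc k)) (ℕ.*-comm (suc k) (suc n)) ⟩
  - + (suc n ℕ.* suc k ℕ./ suc k)     ≡⟨ cong (-_ ∘ +_) (ℕ.m*n/n≡m (suc n) (suc k)) ⟩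
  -[1+ n ]                            ∎
  where
  -[1+m]/ℕd : ∀ m d .{{_ : ℕ.NonZero d}} → suc m % d ≡ 0 → -[1+ m ] /ℕ d ≡ - + (suc m ℕ./ d)
  -[1+m]/ℕd m d eq rewrite eq = refl
  [1+k][1+n]%[1+k]≡0 : suc k ℕ.* suc n % suc k ≡ 0
  [1+k][1+n]%[1+k]≡0 = trans (cong (_% suc k) (ℕ.*-comm (suc k) (suc n))) (ℕ.m*n%n≡0 (suc n) (suc k))

red-*ₗ : ∀ k M → Primitive M → red (+[1+ k ] *ₗ M) ≡ M
red-*ₗ k M@(mat p q r s) primM = begin
  red (+[1+ k ] *ₗ M)            ≡⟨ cong (λ g → divBy g (+[1+ k ] *ₗ M)) content≡1+k ⟩
  divBy (suc k) (+[1+ k ] *ₗ M)  ≡⟨ mat-cong ([1+k]*i/ℕ[1+k]≡i k p) ([1+k]*i/ℕ[1+k]≡i k q)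
                                             ([1+k]*i/ℕ[1+k]≡i k r) ([1+k]*i/ℕ[1+k]≡i k s) ⟩
  M                              ∎
  where
  content≡1+k : content (+[1+ k ] *ₗ M) ≡ suc k
  content≡1+k = trans (content-*ₗ +[1+ k ] M) (trans (cong (suc k ℕ.*_) primM) (ℕ.*-identityʳ (suc k)))

red-primitive : ∀ {M} → Primitive M → red M ≡ M
red-primitive {M} primM = subst (λ A → red A ≡ M) (*ₗ-identityˡ M) (red-*ₗ 0 M primM)

det-red-*ₗ : ∀ {k} M → k ≢ 0ℤ → Primitive M → det (red (k *ₗ M)) ≡ det M
det-red-*ₗ {+ 0}      _ k≢0 _ = contradiction refl k≢0
det-red-*ₗ {+[1+ k ]} M _ primM = cong det (red-*ₗ k M primM)
det-red-*ₗ { -[1+ k ]} M _ primM = begin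
  det (red (-[1+ k ] *ₗ M))            ≡⟨ cong (λ j → det (red (j *ₗ M))) -[1+k]≡[1+k]*-1 ⟩
  det (red ((+[1+ k ] * -1ℤ) *ₗ M))    ≡⟨ cong (det ∘ red) (*ₗ-assoc +[1+ k ] -1ℤ M) ⟩
  det (red (+[1+ k ] *ₗ (-1ℤ *ₗ M)))   ≡⟨ cong det (red-*ₗ k (-1ℤ *ₗ M) primitive[-M]) ⟩
  det (-1ℤ *ₗ M)                       ≡⟨ det-*ₗ -1ℤ M ⟩
  -1ℤ * (-1ℤ * det M)                  ≡⟨ sym (*-assoc -1ℤ -1ℤ (det M)) ⟩
  1ℤ * det M                           ≡⟨ *-identityˡ (det M) ⟩
  det M                                ∎
  where
  -[1+k]≡[1+k]*-1 : -[1+ k ] ≡ +[1+ k ] * -1ℤ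
  -[1+k]≡[1+k]*-1 = trans (sym (-1*i≡-i +[1+ k ])) (*-comm -1ℤ +[1+ k ])
  primitive[-M] : Primitive (-1ℤ *ₗ M)
  primitive[-M] = trans (content-*ₗ -1ℤ M) (trans (ℕ.*-identityˡ (content M)) primM)

⊛-unimodular : ∀ A N → Primitive A → det N ≡ 1ℤ → A ⊛ N ≡ A · N
⊛-unimodular A N primA det≡1 = red-primitive (primitive-·-unimodular A N primA det≡1)

det-⊛-unimodular : ∀ A N → Primitive A → det N ≡ 1ℤ → det (A ⊛ N) ≡ det A
det-⊛-unimodular A N primA det≡1 = begin
  det (A ⊛ N)    ≡⟨ cong det (⊛-unimodular A N primA det≡1) ⟩
  det (A · N)    ≡⟨ det-· A N ⟩
  det A * det N  ≡⟨ cong (det A *_) det≡1 ⟩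
  det A * 1ℤ     ≡⟨ *-identityʳ (det A) ⟩
  det A          ∎

-- The implicit endpoint {Y ⊛ N} below is supplied by hand: left to unification, Agda unfolds ⊛
-- and normalises the gcds inside content, which takes about a minute.
det-⊛-⊛ : ∀ {m} X Y N → m ≢ 0ℤ → Primitive Y → det X ≡ m → det Y ≡ m → m ∣ᴹ X · Y → det N ≡ 1ℤ →
          det (X ⊛ (Y ⊛ N)) ≡ 1ℤ
det-⊛-⊛ {m} X Y N m≢0 primY detX≡m detY≡m (divides Q X·Y≡mQ) detN≡1 = begin
  det (X ⊛ (Y ⊛ N))         ≡⟨ cong (λ Z → det (X ⊛ Z)) {Y ⊛ N} (⊛-unimodular Y N primY detN≡1) ⟩
  det (red (X · (Y · N)))   ≡⟨ cong (det ∘ red) X·[Y·N]≡m[Q·N] ⟩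
  det (red (m *ₗ (Q · N)))  ≡⟨ det-red-*ₗ (Q · N) m≢0 (det≡1⇒primitive (Q · N) detQN≡1) ⟩
  det (Q · N)               ≡⟨ detQN≡1 ⟩
  1ℤ                        ∎
  where
  instance
    m-nonZero : NonZero m
    m-nonZero = ≢-nonZero m≢0
  m²detQ≡m² : m * (m * det Q) ≡ m * (m * 1ℤ)
  m²detQ≡m² = begin
    m * (m * det Q)  ≡⟨ sym (det-*ₗ m Q) ⟩
    det (m *ₗ Q)     ≡⟨ cong det (sym X·Y≡mQ) ⟩
    det (X · Y)      ≡⟨ det-· X Y ⟩
    det X * det Y    ≡⟨ cong₂ _*_ detX≡m detY≡m ⟩
    m * m            ≡⟨ cong (m *_) (sym (*-identityʳ m)) ⟩
    m * (m * 1ℤ)     ∎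
  detQ≡1 : det Q ≡ 1ℤ
  detQ≡1 = *-cancelˡ-≡ m (det Q) 1ℤ (*-cancelˡ-≡ m (m * det Q) (m * 1ℤ) m²detQ≡m²)
  detQN≡1 : det (Q · N) ≡ 1ℤ
  detQN≡1 = trans (det-· Q N) (cong₂ _*_ detQ≡1 detN≡1)
  X·[Y·N]≡m[Q·N] : X · (Y · N) ≡ m *ₗ (Q · N)
  X·[Y·N]≡m[Q·N] = trans (sym (·-assoc X Y N)) (trans (cong (_· N) X·Y≡mQ) (*ₗ-· m Q N))

infix 4 _≡_[modℤ_]

_≡_[modℤ_] : ℤ → ℤ → ℤ → Set
x ≡ y [modℤ m ] = m ∣ x - y

modℤ-trans : ∀ {m} x y z → x ≡ y [modℤ m ] → y ≡ z [modℤ m ] → x ≡ z [modℤ m ]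
modℤ-trans {m} x y z x≡y y≡z =
  ∣⇒∣ᵤ (subst (m Signed.∣_) (identity x y z) (∣m∣n⇒∣m+n {m} {x - y} {y - z} (∣ᵤ⇒∣ x≡y) (∣ᵤ⇒∣ y≡z)))
  where
  identity : ∀ x y z → (x - y) + (y - z) ≡ x - z
  identity = solve-∀

+-cong-modℤ : ∀ {m} x x′ y y′ → x ≡ x′ [modℤ m ] → y ≡ y′ [modℤ m ] → x + y ≡ x′ + y′ [modℤ m ]
+-cong-modℤ {m} x x′ y y′ x≡x′ y≡y′ =
  ∣⇒∣ᵤ (subst (m Signed.∣_) (identity x x′ y y′) (∣m∣n⇒∣m+n {m} {x - x′} {y - y′} (∣ᵤ⇒∣ x≡x′) (∣ᵤ⇒∣ y≡y′)))
  where
  identity : ∀ x x′ y y′ → (x - x′) + (y - y′) ≡ (x + y) - (x′ + y′)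
  identity = solve-∀

*-cong-modℤ : ∀ {m} x x′ y y′ → x ≡ x′ [modℤ m ] → y ≡ y′ [modℤ m ] → x * y ≡ x′ * y′ [modℤ m ]
*-cong-modℤ {m} x x′ y y′ x≡x′ y≡y′ =
  ∣⇒∣ᵤ (subst (m Signed.∣_) (identity x x′ y y′)
    (∣m∣n⇒∣m+n (∣n⇒∣m*n x {y - y′} (∣ᵤ⇒∣ y≡y′)) (∣m⇒∣m*n {m} {x - x′} y′ (∣ᵤ⇒∣ x≡x′))))
  where
  identity : ∀ x x′ y y′ → x * (y - y′) + (x - x′) * y′ ≡ x * y - x′ * y′
  identity = solve-∀

mod-trans : ∀ {m} A B C → A ≡ B [mod m ] → B ≡ C [mod m ] → A ≡ C [mod m ]
mod-trans {m} (mat a₁ a₂ a₃ a₄) (mat b₁ b₂ b₃ b₄) (mat c₁ c₂ c₃ c₄) (p₁ , p₂ , p₃ , p₄) (q₁ , q₂ , q₃ , q₄) =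
  modℤ-trans {m} a₁ b₁ c₁ p₁ q₁ , modℤ-trans {m} a₂ b₂ c₂ p₂ q₂ ,
  modℤ-trans {m} a₃ b₃ c₃ p₃ q₃ , modℤ-trans {m} a₄ b₄ c₄ p₄ q₄

·-cong-mod : ∀ {m} A A′ B B′ → A ≡ A′ [mod m ] → B ≡ B′ [mod m ] → (A · B) ≡ (A′ · B′) [mod m ]
·-cong-mod {m} (mat a₁ a₂ a₃ a₄) (mat a₁′ a₂′ a₃′ a₄′) (mat b₁ b₂ b₃ b₄) (mat b₁′ b₂′ b₃′ b₄′)
           (p₁ , p₂ , p₃ , p₄) (q₁ , q₂ , q₃ , q₄) =
  entry a₁ a₁′ a₂ a₂′ b₁ b₁′ b₃ b₃′ p₁ p₂ q₁ q₃ , entry a₁ a₁′ a₂ a₂′ b₂ b₂′ b₄ b₄′ p₁ p₂ q₂ q₄ ,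
  entry a₃ a₃′ a₄ a₄′ b₁ b₁′ b₃ b₃′ p₃ p₄ q₁ q₃ , entry a₃ a₃′ a₄ a₄′ b₂ b₂′ b₄ b₄′ p₃ p₄ q₂ q₄
  where
  entry : ∀ x x′ y y′ u u′ v v′ → x ≡ x′ [modℤ m ] → y ≡ y′ [modℤ m ] → u ≡ u′ [modℤ m ] → v ≡ v′ [modℤ m ] →
          x * u + y * v ≡ x′ * u′ + y′ * v′ [modℤ m ]
  entry x x′ y y′ u u′ v v′ x≡x′ y≡y′ u≡u′ v≡v′ =
    +-cong-modℤ {m} (x * u) (x′ * u′) (y * v) (y′ * v′)
      (*-cong-modℤ {m} x x′ u u′ x≡x′ u≡u′) (*-cong-modℤ {m} y y′ v v′ y≡y′ v≡v′)

≡0-mod⇒∣ᴹ : ∀ {m} M → M ≡ mat 0ℤ 0ℤ 0ℤ 0ℤ [mod m ] → m ∣ᴹ M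
≡0-mod⇒∣ᴹ {m} (mat p q r s) (p≡0 , q≡0 , r≡0 , s≡0) =
  ∣-entries⇒∣ᴹ (∣ᵤ⇒∣ (x≡0⇒m∣x p p≡0)) (∣ᵤ⇒∣ (x≡0⇒m∣x q q≡0)) (∣ᵤ⇒∣ (x≡0⇒m∣x r r≡0)) (∣ᵤ⇒∣ (x≡0⇒m∣x s s≡0))
  where
  x≡0⇒m∣x : ∀ x → x ≡ 0ℤ [modℤ m ] → m ∣ x
  x≡0⇒m∣x x = subst (m ∣_) (+-identityʳ x)

[1+n]%2≡1⇒n%2≡0 : ∀ n → suc n % 2 ≡ 1 → n % 2 ≡ 0
[1+n]%2≡1⇒n%2≡0 0             _ = refl
[1+n]%2≡1⇒n%2≡0 (suc (suc n)) h = [1+n]%2≡1⇒n%2≡0 n h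

letter : Mat → Mat → Letter → Mat
letter Wa Wb a = Wa
letter Wa Wb b = Wb

letter-elim : ∀ (P : Mat → Set) {Wa Wb} → P Wa → P Wb → ∀ x → P (letter Wa Wb x)
letter-elim _ Pa Pb a = Pa
letter-elim _ Pa Pb b = Pb

Φ-∷ : ∀ Wa Wb x u → Φ Wa Wb (x ∷ u) ≡ letter Wa Wb x ⊛ Φ Wa Wb u
Φ-∷ Wa Wb a u = refl
Φ-∷ Wa Wb b u = refl

module _ {m : ℤ} (m≢0 : m ≢ 0ℤ) {Wa Wb : Mat}
         (letter-primitive : ∀ x → Primitive (letter Wa Wb x))
         (det≡m : ∀ x → det (letter Wa Wb x) ≡ m)
         (m∣product : ∀ x y → m ∣ᴹ letter Wa Wb x · letter Wa Wb y) where

  private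
    L : Letter → Mat
    L = letter Wa Wb

  det-Φ-even : ∀ u → length u % 2 ≡ 0 → det (Φ Wa Wb u) ≡ 1ℤ
  det-Φ-even []          _    = refl
  det-Φ-even (x ∷ y ∷ u) even = begin
    det (Φ Wa Wb (x ∷ y ∷ u))          ≡⟨ cong det Φ[xyu]≡ ⟩
    det (L x ⊛ (L y ⊛ Φ Wa Wb u))      ≡⟨ det-⊛-⊛ (L x) (L y) (Φ Wa Wb u) m≢0 (letter-primitive y)
                                            (det≡m x) (det≡m y) (m∣product x y) (det-Φ-even u even) ⟩
    1ℤ                                 ∎
    where
    Φ[xyu]≡ : Φ Wa Wb (x ∷ y ∷ u) ≡ L x ⊛ (L y ⊛ Φ Wa Wb u)
    Φ[xyu]≡ = trans (Φ-∷ Wa Wb x (y ∷ u)) (cong (L x ⊛_) (Φ-∷ Wa Wb y u))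

  det-Φ-odd : ∀ u → length u % 2 ≡ 1 → det (Φ Wa Wb u) ≡ m
  det-Φ-odd (x ∷ u) odd = begin
    det (Φ Wa Wb (x ∷ u))  ≡⟨ cong det (Φ-∷ Wa Wb x u) ⟩
    det (L x ⊛ Φ Wa Wb u)  ≡⟨ det-⊛-unimodular (L x) (Φ Wa Wb u) (letter-primitive x)
                                (det-Φ-even u ([1+n]%2≡1⇒n%2≡0 (length u) odd)) ⟩
    det (L x)              ≡⟨ det≡m x ⟩
    m                      ∎

lemma6p1 : (m : ℤ) → m ≢ 0ℤ → (W : Mat) → (W · W) ≡ mat 0ℤ 0ℤ 0ℤ 0ℤ [mod m ] →
    (W₁ W₂ : Mat) → Primitive W₁ → Primitive W₂ → det W₁ ≡ m → det W₂ ≡ m →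
    W₁ ≡ W [mod m ] → W₂ ≡ W [mod m ] →
    (u : List Letter) →
      (length u % 2 ≡ 0 → det (Φ W₂ W₁ u) ≡ 1ℤ) ×
      (length u % 2 ≡ 1 → det (Φ W₂ W₁ u) ≡ m)
lemma6p1 m m≢0 W W²≡0 W₁ W₂ primW₁ primW₂ detW₁≡m detW₂≡m W₁≡W W₂≡W u =
  det-Φ-even m≢0 letter-primitive det≡m m∣product u , det-Φ-odd m≢0 letter-primitive det≡m m∣product u
  where
  L : Letter → Mat
  L = letter W₂ W₁
  letter-primitive : ∀ x → Primitive (L x)
  letter-primitive = letter-elim Primitive primW₂ primW₁
  det≡m : ∀ x → det (L x) ≡ m
  det≡m = letter-elim (λ M → det M ≡ m) detW₂≡m detW₁≡m
  L≡W : ∀ x → L x ≡ W [mod m ]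
  L≡W = letter-elim (_≡ W [mod m ]) W₂≡W W₁≡W
  m∣product : ∀ x y → m ∣ᴹ L x · L y
  m∣product x y = ≡0-mod⇒∣ᴹ (L x · L y) LxLy≡0
    where
    LxLy≡0 : (L x · L y) ≡ mat 0ℤ 0ℤ 0ℤ 0ℤ [mod m ]
    LxLy≡0 = mod-trans {m} (L x · L y) (W · W) (mat 0ℤ 0ℤ 0ℤ 0ℤ)
               (·-cong-mod {m} (L x) W (L y) W (L≡W x) (L≡W y)) W²≡0
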